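{- Let $G$ be a finite $d$-regular graph on $n$ vertices. Let $S_1$ be an independent exact $r_1$-cover of $G$, $S_2$ an independent exact $r_2$-cover of $G$, and $S_3$ an independent exact $d$-cover of $G$, where $r_1 \ne r_2$ and both $r_1, r_2$ are distinct from $d$. Then \[|S_1 \cap S_2 \cap S_3| = \frac{|S_1|\,|S_2|\,|S_3|}{n^2} = \frac{r_1 r_2 n}{2(d+r_1)(d+r_2)}.\]
   Context: Let $G$ be a $d$-regular simple graph. For $0 \le r \le d$, an independent exact $r$-cover of $G$ is a subset $S \subseteq V(G)$ such that no edge of $G$ has both endpoints in $S$, and every vertex of $V(G)\setminus S$ is adjacent to exactly $r$ vertices of $S$. -}

module Defs where

open import Data.Nat using (ℕ; _≤_)
open import Data.Fin using (Fin)
open import Data.Fin.Subset using (Subset; _∈_; _∉_; _∩_; ∣_∣)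
open import Data.Product using (_×_)
open import Relation.Binary.PropositionalEquality using (_≡_)

record SimpleGraph (n : ℕ) : Set where
  field
    N         : Fin n → Subset n
    symmetric : ∀ u v → v ∈ N u → u ∈ N v
    irrefl    : ∀ v → v ∉ N v
open SimpleGraph public

Regular : ∀ {n} → SimpleGraph n → ℕ → Set
Regular G d = ∀ v → ∣ N G v ∣ ≡ d

Independent : ∀ {n} → SimpleGraph n → Subset n → Set
Independent G S = ∀ u v → u ∈ S → v ∈ S → v ∉ N G u

IndepExactCover : ∀ {n} → SimpleGraph n → ℕ → ℕ → Subset n → Set
IndepExactCover G d r S =
  r ≤ d × Independent G S × (∀ v → v ∉ S → ∣ N G v ∩ S ∣ ≡ r)

{-# OPTIONS --safe #-}
module Submission where

-- Let A be the adjacency matrix of G, 𝟏 the all-ones vector and 𝟙 S the indicator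
-- vector of S. Then A 𝟏 = d 𝟏, and an independent exact r-cover S satisfies
-- A 𝟙 S = r (𝟏 - 𝟙 S), so x_S = (d + r) 𝟙 S - r 𝟏 is an eigenvector for -r.
-- An independent exact d-cover B makes G bipartite with parts B and its complement,
-- so σ = 𝟏 - 2 𝟙 B anticommutes with A: twisting an eigenvector by σ negates its
-- eigenvalue. As A is symmetric, eigenvectors for distinct eigenvalues are
-- orthogonal. Applied to 𝟏, σ ⊙ 𝟏, x_S₁, x_S₂, σ ⊙ x_S₂ and using 2 𝟙 B = 𝟏 - σ,
-- this gives
--   (d + r) |S| = r n,   n = 2 |B|,   (d + r) |S ∩ B| = r |B|,
--   (d + r₁) (d + r₂) |S₁ ∩ S₂ ∩ B| = r₁ r₂ |B|,
-- from which both identities follow by arithmetic.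

open import Defs

-- Kept in its own module so that _+_ and _*_ are the ℤ operations here and the
-- ℕ operations in the theorem.
module Spectral where
  open import Data.Bool.Base using (true; false; _∧_; if_then_else_)
  open import Data.Empty using (⊥-elim)
  open import Data.Fin.Base using (Fin)
  open import Data.Fin.Subset using (Subset; _∈_; _∉_; _∩_; _⊆_; ∣_∣; ⊥; Empty)
  open import Data.Fin.Subset.Properties
    using (_∈?_; x∈p∩q⁻; p∩q⊆p; p⊂q⇒∣p∣<∣q∣; Empty-unique; ∣⊥∣≡0)
  open import Data.Integer.Base using (ℤ; +_; -_; _+_; _-_; _*_; 0ℤ; 1ℤ; ≢-nonZero)
  import Data.Integer.Properties as ℤ
  import Data.Integer.Tactic.RingSolver as ℤ-Solver
  open import Data.Nat.Base as ℕ using (ℕ; zero; suc)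
  import Data.Nat.Properties as ℕ
  open import Data.Product using (_,_; proj₁; proj₂)
  open import Data.Vec.Base using ([]; _∷_; lookup)
  open import Data.Vec.Functional using (Vector)
  open import Data.Vec.Properties using ([]=⇒lookup; lookup⇒[]=; lookup-zipWith)
  open import Function.Base using (_∘_)
  open import Relation.Binary.PropositionalEquality
  open import Relation.Nullary using (yes; no)
  open import Algebra.Properties.Semiring.Sum ℤ.+-*-semiring
    using (sum; sum-cong-≗; ∑-distrib-+; ∑-comm; *-distribˡ-sum; *-distribʳ-sum)

  open ≡-Reasoning

  private
    variable
      n : ℕ

  a*x≡b*x⇒x≡0 : ∀ {a b x} → a ≢ b → a * x ≡ b * x → x ≡ 0ℤ
  a*x≡b*x⇒x≡0 {a} {b} {x} a≢b eq with x ℤ.≟ 0ℤ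
  ... | yes x≡0 = x≡0
  ... | no  x≢0 = ⊥-elim (a≢b (ℤ.*-cancelʳ-≡ a b x {{≢-nonZero x≢0}} eq))

  -m≡n⇒m≡n : ∀ {m k} → - + m ≡ + k → m ≡ k
  -m≡n⇒m≡n {zero}  eq = ℤ.+-injective eq
  -m≡n⇒m≡n {suc m} ()

  m≢0⇒m≢-m : ∀ {m} → m ≢ 0 → + m ≢ - + m
  m≢0⇒m≢-m {zero}  m≢0 _ = m≢0 refl
  m≢0⇒m≢-m {suc m} _ ()

  m*n-o*p≡0⇒m*n≡o*p : ∀ m n o p → + m * + n + - + o * + p ≡ 0ℤ → m ℕ.* n ≡ o ℕ.* p
  m*n-o*p≡0⇒m*n≡o*p m n o p eq = ℤ.+-injective (begin
    + (m ℕ.* n)     ≡⟨ ℤ.pos-* m n ⟩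
    + m * + n       ≡⟨ ℤ.i-j≡0⇒i≡j _ _ m*n-o*p≡0 ⟩
    + o * + p       ≡⟨ ℤ.pos-* o p ⟨
    + (o ℕ.* p)     ∎)
    where
    m*n-o*p≡0 : + m * + n - + o * + p ≡ 0ℤ
    m*n-o*p≡0 = trans (cong (λ q → + m * + n + q) (ℤ.neg-distribˡ-* (+ o) (+ p))) eq

  pos-*³ : ∀ m n o → + (m ℕ.* n ℕ.* o) ≡ + m * + n * + o
  pos-*³ m n o = trans (ℤ.pos-* (m ℕ.* n) o) (cong (_* + o) (ℤ.pos-* m n))

  p₁p₂k≡r₁r₂m : ∀ {p₁ p₂ r₁ r₂ k t₁ t₂ m} →
                p₁ * t₁ + - r₁ * m ≡ 0ℤ → p₂ * t₂ + - r₂ * m ≡ 0ℤ →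
                p₂ * (p₁ * k + - r₁ * t₂) + - r₂ * (p₁ * t₁ + - r₁ * m) ≡ 0ℤ →
                p₁ * p₂ * k ≡ r₁ * r₂ * m
  p₁p₂k≡r₁r₂m {p₁} {p₂} {r₁} {r₂} {k} {t₁} {t₂} {m} e₁ e₂ e = begin
    p₁ * p₂ * k
      ≡⟨ decompose p₁ p₂ r₁ r₂ k t₁ t₂ m ⟩
    (p₂ * (p₁ * k + - r₁ * t₂) + - r₂ * (p₁ * t₁ + - r₁ * m))
      + r₂ * (p₁ * t₁ + - r₁ * m) + r₁ * (p₂ * t₂ + - r₂ * m) + r₁ * r₂ * m
      ≡⟨ cong₂ (λ x y → x + r₂ * y + r₁ * (p₂ * t₂ + - r₂ * m) + r₁ * r₂ * m) e e₁ ⟩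
    0ℤ + r₂ * 0ℤ + r₁ * (p₂ * t₂ + - r₂ * m) + r₁ * r₂ * m
      ≡⟨ cong (λ y → 0ℤ + r₂ * 0ℤ + r₁ * y + r₁ * r₂ * m) e₂ ⟩
    0ℤ + r₂ * 0ℤ + r₁ * 0ℤ + r₁ * r₂ * m
      ≡⟨ simplify r₁ r₂ m ⟩
    r₁ * r₂ * m
      ∎
    where
    decompose : ∀ p₁ p₂ r₁ r₂ k t₁ t₂ m → p₁ * p₂ * k ≡
                (p₂ * (p₁ * k + - r₁ * t₂) + - r₂ * (p₁ * t₁ + - r₁ * m))
                  + r₂ * (p₁ * t₁ + - r₁ * m) + r₁ * (p₂ * t₂ + - r₂ * m) + r₁ * r₂ * m
    decompose = ℤ-Solver.solve-∀
    simplify : ∀ r₁ r₂ m → 0ℤ + r₂ * 0ℤ + r₁ * 0ℤ + r₁ * r₂ * m ≡ r₁ * r₂ * m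
    simplify = ℤ-Solver.solve-∀

  _⊙_ : Vector ℤ n → Vector ℤ n → Vector ℤ n
  (x ⊙ y) v = x v * y v

  ⟨_,_⟩ : Vector ℤ n → Vector ℤ n → ℤ
  ⟨ x , y ⟩ = sum (x ⊙ y)

  ⟨⟩-comm : ∀ (x y : Vector ℤ n) → ⟨ x , y ⟩ ≡ ⟨ y , x ⟩
  ⟨⟩-comm x y = sum-cong-≗ (λ v → ℤ.*-comm (x v) (y v))

  ⟨⟩-*ʳ : ∀ a (x y : Vector ℤ n) → ⟨ x , (λ v → a * y v) ⟩ ≡ a * ⟨ x , y ⟩
  ⟨⟩-*ʳ a x y = begin
    sum (λ v → x v * (a * y v)) ≡⟨ sum-cong-≗ (λ v → swap (x v) a (y v)) ⟩
    sum (λ v → a * (x v * y v)) ≡⟨ *-distribˡ-sum a (x ⊙ y) ⟨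
    a * ⟨ x , y ⟩               ∎
    where
    swap : ∀ p q r → p * (q * r) ≡ q * (p * r)
    swap = ℤ-Solver.solve-∀

  ⟨⟩-*ˡ : ∀ a (x y : Vector ℤ n) → ⟨ (λ v → a * x v) , y ⟩ ≡ a * ⟨ x , y ⟩
  ⟨⟩-*ˡ a x y = begin
    ⟨ (λ v → a * x v) , y ⟩ ≡⟨ ⟨⟩-comm _ y ⟩
    ⟨ y , (λ v → a * x v) ⟩ ≡⟨ ⟨⟩-*ʳ a y x ⟩
    a * ⟨ y , x ⟩           ≡⟨ cong (a *_) (⟨⟩-comm y x) ⟩
    a * ⟨ x , y ⟩           ∎

  ⟨⟩-linearʳ : ∀ a b (x y z : Vector ℤ n) →
               ⟨ x , (λ v → a * y v + b * z v) ⟩ ≡ a * ⟨ x , y ⟩ + b * ⟨ x , z ⟩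
  ⟨⟩-linearʳ a b x y z = begin
    ⟨ x , (λ v → a * y v + b * z v) ⟩                  ≡⟨ sum-cong-≗ (λ v → ℤ.*-distribˡ-+ (x v) _ _) ⟩
    sum (λ v → x v * (a * y v) + x v * (b * z v))      ≡⟨ ∑-distrib-+ (λ v → x v * (a * y v)) _ ⟩
    ⟨ x , (λ v → a * y v) ⟩ + ⟨ x , (λ v → b * z v) ⟩  ≡⟨ cong₂ _+_ (⟨⟩-*ʳ a x y) (⟨⟩-*ʳ b x z) ⟩
    a * ⟨ x , y ⟩ + b * ⟨ x , z ⟩                      ∎

  ⟨⟩-linearˡ : ∀ a b (x y z : Vector ℤ n) →
               ⟨ (λ v → a * x v + b * y v) , z ⟩ ≡ a * ⟨ x , z ⟩ + b * ⟨ y , z ⟩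
  ⟨⟩-linearˡ a b x y z = begin
    ⟨ (λ v → a * x v + b * y v) , z ⟩ ≡⟨ ⟨⟩-comm _ z ⟩
    ⟨ z , (λ v → a * x v + b * y v) ⟩ ≡⟨ ⟨⟩-linearʳ a b z x y ⟩
    a * ⟨ z , x ⟩ + b * ⟨ z , y ⟩     ≡⟨ cong₂ (λ p q → a * p + b * q) (⟨⟩-comm z x) (⟨⟩-comm z y) ⟩
    a * ⟨ x , z ⟩ + b * ⟨ y , z ⟩     ∎

  Matrix : ℕ → Set
  Matrix n = Fin n → Fin n → ℤ

  _·ᵥ_ : Matrix n → Vector ℤ n → Vector ℤ n
  (M ·ᵥ x) u = ⟨ M u , x ⟩

  SymmetricMatrix : Matrix n → Set
  SymmetricMatrix M = ∀ u v → M u v ≡ M v u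

  InEigenspace : Matrix n → ℤ → Vector ℤ n → Set
  InEigenspace M a x = ∀ u → (M ·ᵥ x) u ≡ a * x u

  ·ᵥ-selfAdjoint : ∀ {M : Matrix n} → SymmetricMatrix M →
                   ∀ x y → ⟨ M ·ᵥ x , y ⟩ ≡ ⟨ x , M ·ᵥ y ⟩
  ·ᵥ-selfAdjoint {M = M} M-sym x y = begin
    sum (λ u → sum (λ v → M u v * x v) * y u)   ≡⟨ sum-cong-≗ (λ u → *-distribʳ-sum (y u) (λ v → M u v * x v)) ⟩
    sum (λ u → sum (λ v → M u v * x v * y u))   ≡⟨ ∑-comm (λ u v → M u v * x v * y u) ⟩
    sum (λ v → sum (λ u → M u v * x v * y u))   ≡⟨ sum-cong-≗ (λ v → sum-cong-≗ (λ u → transpose u v)) ⟩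
    sum (λ v → sum (λ u → x v * (M v u * y u))) ≡⟨ sum-cong-≗ (λ v → *-distribˡ-sum (x v) (λ u → M v u * y u)) ⟨
    sum (λ v → x v * sum (λ u → M v u * y u))   ∎
    where
    rearrange : ∀ m p q → m * p * q ≡ p * (m * q)
    rearrange = ℤ-Solver.solve-∀
    transpose : ∀ u v → M u v * x v * y u ≡ x v * (M v u * y u)
    transpose u v = trans (cong (λ m → m * x v * y u) (M-sym u v)) (rearrange (M v u) (x v) (y u))

  eigenspaces-orthogonal : ∀ {M : Matrix n} {a b x y} → SymmetricMatrix M →
                           InEigenspace M a x → InEigenspace M b y → a ≢ b → ⟨ x , y ⟩ ≡ 0ℤ
  eigenspaces-orthogonal {M = M} {a} {b} {x} {y} M-sym x∈Eₐ y∈E_b a≢b = a*x≡b*x⇒x≡0 a≢b (begin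
    a * ⟨ x , y ⟩              ≡⟨ ⟨⟩-*ˡ a x y ⟨
    ⟨ (λ v → a * x v) , y ⟩    ≡⟨ sum-cong-≗ (λ v → cong (_* y v) (x∈Eₐ v)) ⟨
    ⟨ M ·ᵥ x , y ⟩             ≡⟨ ·ᵥ-selfAdjoint M-sym x y ⟩
    ⟨ x , M ·ᵥ y ⟩             ≡⟨ sum-cong-≗ (λ v → cong (x v *_) (y∈E_b v)) ⟩
    ⟨ x , (λ v → b * y v) ⟩    ≡⟨ ⟨⟩-*ʳ b x y ⟩
    b * ⟨ x , y ⟩              ∎)

  SignAlternating : Matrix n → Vector ℤ n → Set
  SignAlternating M w = ∀ u v → M u v * w v ≡ M u v * - w u

  alternating-eigenspace : ∀ {M : Matrix n} {w a x} → SignAlternating M w →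
                           InEigenspace M a x → InEigenspace M (- a) (w ⊙ x)
  alternating-eigenspace {M = M} {w} {a} {x} w-alt x∈Eₐ u = begin
    sum (λ v → M u v * (w v * x v))    ≡⟨ sum-cong-≗ flip ⟩
    sum (λ v → - w u * (M u v * x v))  ≡⟨ *-distribˡ-sum (- w u) (λ v → M u v * x v) ⟨
    - w u * (M ·ᵥ x) u                 ≡⟨ cong (- w u *_) (x∈Eₐ u) ⟩
    - w u * (a * x u)                  ≡⟨ regroup (w u) a (x u) ⟩
    - a * (w u * x u)                  ∎
    where
    reassoc : ∀ m p q → m * (p * q) ≡ m * p * q
    reassoc = ℤ-Solver.solve-∀
    commute : ∀ m p q → m * - p * q ≡ - p * (m * q)
    commute = ℤ-Solver.solve-∀
    regroup : ∀ p q r → - p * (q * r) ≡ - q * (p * r)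
    regroup = ℤ-Solver.solve-∀
    flip : ∀ v → M u v * (w v * x v) ≡ - w u * (M u v * x v)
    flip v = trans (reassoc (M u v) (w v) (x v))
                   (trans (cong (_* x v) (w-alt u v)) (commute (M u v) (w u) (x v)))

  sign : Vector ℤ n → Vector ℤ n
  sign w v = 1ℤ - + 2 * w v

  ⟨⟩-sign : ∀ (w x y : Vector ℤ n) → ⟨ x , sign w ⊙ y ⟩ ≡ ⟨ x , y ⟩ - + 2 * ⟨ x , w ⊙ y ⟩
  ⟨⟩-sign w x y = begin
    ⟨ x , sign w ⊙ y ⟩                           ≡⟨ sum-cong-≗ (λ v → cong (x v *_) (expand (w v) (y v))) ⟩
    ⟨ x , (λ v → 1ℤ * y v + - + 2 * (w ⊙ y) v) ⟩ ≡⟨ ⟨⟩-linearʳ 1ℤ (- + 2) x y (w ⊙ y) ⟩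
    1ℤ * ⟨ x , y ⟩ + - + 2 * ⟨ x , w ⊙ y ⟩       ≡⟨ tidy ⟨ x , y ⟩ ⟨ x , w ⊙ y ⟩ ⟩
    ⟨ x , y ⟩ - + 2 * ⟨ x , w ⊙ y ⟩              ∎
    where
    expand : ∀ p q → (1ℤ - + 2 * p) * q ≡ 1ℤ * q + - + 2 * (p * q)
    expand = ℤ-Solver.solve-∀
    tidy : ∀ p q → 1ℤ * p + - + 2 * q ≡ p - + 2 * q
    tidy = ℤ-Solver.solve-∀

  -- Twisting y by sign w negates its eigenvalue, so both ⟨ x , y ⟩ and
  -- ⟨ x , sign w ⊙ y ⟩ = ⟨ x , y ⟩ - 2 ⟨ x , w ⊙ y ⟩ vanish.
  eigenspaces-orthogonal-on : ∀ {M : Matrix n} {w a b x y} → SymmetricMatrix M →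
                              SignAlternating M (sign w) →
                              InEigenspace M a x → InEigenspace M b y → a ≢ b → a ≢ - b →
                              ⟨ x , w ⊙ y ⟩ ≡ 0ℤ
  eigenspaces-orthogonal-on {M = M} {w} {b = b} {x} {y} M-sym σ-alt x∈Eₐ y∈E_b a≢b a≢-b =
    a*x≡b*x⇒x≡0 {a = + 2} {b = 0ℤ} (λ ()) (begin
      + 2 * ⟨ x , w ⊙ y ⟩                          ≡⟨ cancel ⟨ x , y ⟩ ⟨ x , w ⊙ y ⟩ ⟩
      ⟨ x , y ⟩ - (⟨ x , y ⟩ - + 2 * ⟨ x , w ⊙ y ⟩) ≡⟨ cong₂ _-_ x⊥y (trans (sym (⟨⟩-sign w x y)) x⊥σy) ⟩
      0ℤ - 0ℤ                                      ∎)
    where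
    x⊥y : ⟨ x , y ⟩ ≡ 0ℤ
    x⊥y = eigenspaces-orthogonal M-sym x∈Eₐ y∈E_b a≢b
    x⊥σy : ⟨ x , sign w ⊙ y ⟩ ≡ 0ℤ
    x⊥σy = eigenspaces-orthogonal M-sym x∈Eₐ
             (alternating-eigenspace {M = M} {sign w} {b} {y} σ-alt y∈E_b) a≢-b
    cancel : ∀ p q → + 2 * q ≡ p - (p - + 2 * q)
    cancel = ℤ-Solver.solve-∀

  𝟏 : Vector ℤ n
  𝟏 _ = 1ℤ

  𝟙 : Subset n → Vector ℤ n
  𝟙 p v = if lookup p v then 1ℤ else 0ℤ

  𝟙-∈ : ∀ {p : Subset n} {v} → v ∈ p → 𝟙 p v ≡ 1ℤ
  𝟙-∈ v∈p rewrite []=⇒lookup v∈p = refl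

  𝟙-∉ : ∀ {p : Subset n} {v} → v ∉ p → 𝟙 p v ≡ 0ℤ
  𝟙-∉ {p = p} {v} v∉p with lookup p v in eq
  ... | true  = ⊥-elim (v∉p (lookup⇒[]= v p eq))
  ... | false = refl

  𝟙-∩ : ∀ (p q : Subset n) v → 𝟙 (p ∩ q) v ≡ 𝟙 p v * 𝟙 q v
  𝟙-∩ p q v rewrite lookup-zipWith _∧_ v p q with lookup p v
  ... | true  = sym (ℤ.*-identityˡ _)
  ... | false = refl

  sum-𝟙 : ∀ (p : Subset n) → sum (𝟙 p) ≡ + ∣ p ∣
  sum-𝟙 []          = refl
  sum-𝟙 (true ∷ p)  = cong (λ s → 1ℤ + s) (sum-𝟙 p)
  sum-𝟙 (false ∷ p) = trans (cong (λ s → 0ℤ + s) (sum-𝟙 p)) (ℤ.+-identityˡ _)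

  ⟨𝟙,𝟙⟩ : ∀ (p q : Subset n) → ⟨ 𝟙 p , 𝟙 q ⟩ ≡ + ∣ p ∩ q ∣
  ⟨𝟙,𝟙⟩ p q = trans (sum-cong-≗ (sym ∘ 𝟙-∩ p q)) (sum-𝟙 (p ∩ q))

  ⟨𝟏,𝟙⟩ : ∀ (p : Subset n) → ⟨ 𝟏 , 𝟙 p ⟩ ≡ + ∣ p ∣
  ⟨𝟏,𝟙⟩ p = trans (sum-cong-≗ (ℤ.*-identityˡ ∘ 𝟙 p)) (sum-𝟙 p)

  ⟨𝟏,𝟏⟩ : ⟨ 𝟏 {n} , 𝟏 ⟩ ≡ + n
  ⟨𝟏,𝟏⟩ {zero}  = refl
  ⟨𝟏,𝟏⟩ {suc n} = cong (λ s → 1ℤ + s) (⟨𝟏,𝟏⟩ {n})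

  ∣p∩q∣≡∣p∣⇒p⊆q : ∀ {p q : Subset n} → ∣ p ∩ q ∣ ≡ ∣ p ∣ → p ⊆ q
  ∣p∩q∣≡∣p∣⇒p⊆q {p = p} {q} eq {v} v∈p with v ∈? q
  ... | yes v∈q = v∈q
  ... | no  v∉q = ⊥-elim (ℕ.<-irrefl eq (p⊂q⇒∣p∣<∣q∣ (p∩q⊆p p q , v , v∈p , v∉q ∘ proj₂ ∘ x∈p∩q⁻ p q)))

  adjacency : SimpleGraph n → Matrix n
  adjacency G u = 𝟙 (N G u)

  adjacency-symmetric : ∀ (G : SimpleGraph n) → SymmetricMatrix (adjacency G)
  adjacency-symmetric G u v with v ∈? N G u
  ... | yes v∈Nu = trans (𝟙-∈ v∈Nu) (sym (𝟙-∈ (symmetric G u v v∈Nu)))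
  ... | no  v∉Nu = trans (𝟙-∉ v∉Nu) (sym (𝟙-∉ (v∉Nu ∘ symmetric G v u)))

  coverVector : ℕ → ℕ → Subset n → Vector ℤ n
  coverVector d r S v = + (d ℕ.+ r) * 𝟙 S v + - + r * 𝟏 v

  ⟨𝟏,coverVector⟩ : ∀ d r (S : Subset n) →
                    ⟨ 𝟏 , coverVector d r S ⟩ ≡ + (d ℕ.+ r) * + ∣ S ∣ + - + r * + n
  ⟨𝟏,coverVector⟩ d r S = trans (⟨⟩-linearʳ (+ (d ℕ.+ r)) (- + r) 𝟏 (𝟙 S) 𝟏)
                                (cong₂ (λ p q → + (d ℕ.+ r) * p + - + r * q) (⟨𝟏,𝟙⟩ S) ⟨𝟏,𝟏⟩)

  ⟨coverVector,𝟙⟩ : ∀ d r (S T : Subset n) →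
                    ⟨ coverVector d r S , 𝟙 T ⟩ ≡ + (d ℕ.+ r) * + ∣ S ∩ T ∣ + - + r * + ∣ T ∣
  ⟨coverVector,𝟙⟩ d r S T = trans (⟨⟩-linearˡ (+ (d ℕ.+ r)) (- + r) (𝟙 S) 𝟏 (𝟙 T))
                                  (cong₂ (λ p q → + (d ℕ.+ r) * p + - + r * q) (⟨𝟙,𝟙⟩ S T) (⟨𝟏,𝟙⟩ T))

  𝟙⊙coverVector : ∀ d r (S B : Subset n) v →
                  (𝟙 B ⊙ coverVector d r S) v ≡ + (d ℕ.+ r) * 𝟙 (S ∩ B) v + - + r * 𝟙 B v
  𝟙⊙coverVector d r S B v = begin
    𝟙 B v * (+ (d ℕ.+ r) * 𝟙 S v + - + r * 1ℤ)    ≡⟨ distribute (𝟙 B v) (+ (d ℕ.+ r)) (𝟙 S v) (- + r) ⟩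
    + (d ℕ.+ r) * (𝟙 S v * 𝟙 B v) + - + r * 𝟙 B v ≡⟨ cong (λ i → + (d ℕ.+ r) * i + - + r * 𝟙 B v) (𝟙-∩ S B v) ⟨
    + (d ℕ.+ r) * 𝟙 (S ∩ B) v + - + r * 𝟙 B v     ∎
    where
    distribute : ∀ b p s q → b * (p * s + q * 1ℤ) ≡ p * (s * b) + q * b
    distribute = ℤ-Solver.solve-∀

  module _ (G : SimpleGraph n) {d} (regular : Regular G d) where

    𝟏-eigenvector : InEigenspace (adjacency G) (+ d) 𝟏
    𝟏-eigenvector u = begin
      ⟨ 𝟙 (N G u) , 𝟏 ⟩   ≡⟨ ⟨⟩-comm (𝟙 (N G u)) 𝟏 ⟩
      ⟨ 𝟏 , 𝟙 (N G u) ⟩   ≡⟨ ⟨𝟏,𝟙⟩ (N G u) ⟩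
      + ∣ N G u ∣         ≡⟨ cong +_ (regular u) ⟩
      + d                 ≡⟨ ℤ.*-identityʳ (+ d) ⟨
      + d * 1ℤ            ∎

    cover-·ᵥ-𝟙 : ∀ {r S} → IndepExactCover G d r S → ∀ u → (adjacency G ·ᵥ 𝟙 S) u ≡ + r * (1ℤ - 𝟙 S u)
    cover-·ᵥ-𝟙 {r} {S} (_ , independent , exact) u with u ∈? S
    ... | yes u∈S = begin
      ⟨ 𝟙 (N G u) , 𝟙 S ⟩  ≡⟨ ⟨𝟙,𝟙⟩ (N G u) S ⟩
      + ∣ N G u ∩ S ∣      ≡⟨ cong (+_ ∘ ∣_∣) (Empty-unique no-neighbour) ⟩
      + ∣ ⊥ {n} ∣          ≡⟨ cong +_ (∣⊥∣≡0 n) ⟩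
      0ℤ                   ≡⟨ ℤ.*-zeroʳ (+ r) ⟨
      + r * 0ℤ             ≡⟨ cong (λ i → + r * (1ℤ - i)) (𝟙-∈ u∈S) ⟨
      + r * (1ℤ - 𝟙 S u)   ∎
      where
      no-neighbour : Empty (N G u ∩ S)
      no-neighbour (v , v∈N∩S) with x∈p∩q⁻ (N G u) S v∈N∩S
      ... | v∈N , v∈S = independent u v u∈S v∈S v∈N
    ... | no u∉S = begin
      ⟨ 𝟙 (N G u) , 𝟙 S ⟩  ≡⟨ ⟨𝟙,𝟙⟩ (N G u) S ⟩
      + ∣ N G u ∩ S ∣      ≡⟨ cong +_ (exact u u∉S) ⟩
      + r                  ≡⟨ ℤ.*-identityʳ (+ r) ⟨
      + r * 1ℤ             ≡⟨ cong (λ i → + r * (1ℤ - i)) (𝟙-∉ u∉S) ⟨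
      + r * (1ℤ - 𝟙 S u)   ∎

    cover-eigenvector : ∀ {r S} → IndepExactCover G d r S →
                        InEigenspace (adjacency G) (- + r) (coverVector d r S)
    cover-eigenvector {r} {S} cover u = begin
      ⟨ 𝟙 (N G u) , coverVector d r S ⟩
        ≡⟨ ⟨⟩-linearʳ (+ (d ℕ.+ r)) (- + r) (𝟙 (N G u)) (𝟙 S) 𝟏 ⟩
      + (d ℕ.+ r) * (adjacency G ·ᵥ 𝟙 S) u + - + r * (adjacency G ·ᵥ 𝟏) u
        ≡⟨ cong₂ (λ p q → + (d ℕ.+ r) * p + - + r * q) (cover-·ᵥ-𝟙 cover u) (𝟏-eigenvector u) ⟩
      + (d ℕ.+ r) * (+ r * (1ℤ - 𝟙 S u)) + - + r * (+ d * 1ℤ)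
        ≡⟨ collect (+ d) (+ r) (𝟙 S u) ⟩
      - + r * coverVector d r S u ∎
      where
      collect : ∀ d r s → (d + r) * (r * (1ℤ - s)) + - r * (d * 1ℤ) ≡ - r * ((d + r) * s + - r * 1ℤ)
      collect = ℤ-Solver.solve-∀

    cover-density : ∀ {r S} → IndepExactCover G d r S → r ≢ d → (d ℕ.+ r) ℕ.* ∣ S ∣ ≡ r ℕ.* n
    cover-density {r} {S} cover r≢d = m*n-o*p≡0⇒m*n≡o*p (d ℕ.+ r) ∣ S ∣ r n (begin
      + (d ℕ.+ r) * + ∣ S ∣ + - + r * + n ≡⟨ ⟨𝟏,coverVector⟩ d r S ⟨
      ⟨ 𝟏 , coverVector d r S ⟩          ≡⟨ eigenspaces-orthogonal (adjacency-symmetric G) 𝟏-eigenvector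
                                              (cover-eigenvector cover) (r≢d ∘ -m≡n⇒m≡n ∘ sym) ⟩
      0ℤ                                 ∎)

    module _ {B : Subset n} (bipartition : IndepExactCover G d d B) where

      neighbour-in-other-part : ∀ {u v} → v ∈ N G u → 𝟙 B v ≡ 1ℤ - 𝟙 B u
      neighbour-in-other-part {u} {v} v∈Nu with u ∈? B
      ... | yes u∈B = trans (𝟙-∉ (λ v∈B → proj₁ (proj₂ bipartition) u v u∈B v∈B v∈Nu))
                            (sym (cong (λ i → 1ℤ - i) (𝟙-∈ u∈B)))
      ... | no  u∉B = trans (𝟙-∈ (Nu⊆B v∈Nu)) (sym (cong (λ i → 1ℤ - i) (𝟙-∉ u∉B)))
        where
        Nu⊆B : N G u ⊆ B
        Nu⊆B = ∣p∩q∣≡∣p∣⇒p⊆q (trans (proj₂ (proj₂ bipartition) u u∉B) (sym (regular u)))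

      sign-alternating : SignAlternating (adjacency G) (sign (𝟙 B))
      sign-alternating u v with v ∈? N G u
      ... | yes v∈Nu = cong (𝟙 (N G u) v *_)
                            (trans (cong (λ i → 1ℤ - + 2 * i) (neighbour-in-other-part v∈Nu)) (flip (𝟙 B u)))
        where
        flip : ∀ i → 1ℤ - + 2 * (1ℤ - i) ≡ - (1ℤ - + 2 * i)
        flip = ℤ-Solver.solve-∀
      ... | no  v∉Nu rewrite 𝟙-∉ v∉Nu = refl

      bipartition-balanced : d ≢ 0 → n ≡ ∣ B ∣ ℕ.+ ∣ B ∣
      bipartition-balanced d≢0 = ℤ.+-injective (begin
        + n                                 ≡⟨ ℤ.i-j≡0⇒i≡j _ _ n-2∣B∣≡0 ⟩
        + 2 * + ∣ B ∣                       ≡⟨ double (+ ∣ B ∣) ⟩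
        + ∣ B ∣ + + ∣ B ∣                   ∎)
        where
        ⟨𝟏,𝟙⊙𝟏⟩ : ⟨ 𝟏 , 𝟙 B ⊙ 𝟏 ⟩ ≡ + ∣ B ∣
        ⟨𝟏,𝟙⊙𝟏⟩ = trans (sum-cong-≗ (λ v → cong (1ℤ *_) (ℤ.*-identityʳ (𝟙 B v)))) (⟨𝟏,𝟙⟩ B)
        n-2∣B∣≡0 : + n - + 2 * + ∣ B ∣ ≡ 0ℤ
        n-2∣B∣≡0 = begin
          + n - + 2 * + ∣ B ∣                        ≡⟨ cong₂ (λ p q → p - + 2 * q) ⟨𝟏,𝟏⟩ ⟨𝟏,𝟙⊙𝟏⟩ ⟨
          ⟨ 𝟏 {n} , 𝟏 ⟩ - + 2 * ⟨ 𝟏 , 𝟙 B ⊙ 𝟏 ⟩      ≡⟨ ⟨⟩-sign (𝟙 B) 𝟏 𝟏 ⟨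
          ⟨ 𝟏 , sign (𝟙 B) ⊙ 𝟏 ⟩
            ≡⟨ eigenspaces-orthogonal (adjacency-symmetric G) 𝟏-eigenvector
                 (alternating-eigenspace {M = adjacency G} {a = + d} {𝟏} sign-alternating 𝟏-eigenvector)
                 (m≢0⇒m≢-m d≢0) ⟩
          0ℤ                                         ∎
        double : ∀ p → + 2 * p ≡ p + p
        double = ℤ-Solver.solve-∀

      cover-density-in-part : ∀ {r S} → IndepExactCover G d r S → r ≢ d →
                              + (d ℕ.+ r) * + ∣ S ∩ B ∣ + - + r * + ∣ B ∣ ≡ 0ℤ
      cover-density-in-part {r} {S} cover r≢d = begin
        + (d ℕ.+ r) * + ∣ S ∩ B ∣ + - + r * + ∣ B ∣
          ≡⟨ cong₂ (λ p q → + (d ℕ.+ r) * p + - + r * q) (⟨𝟏,𝟙⟩ (S ∩ B)) (⟨𝟏,𝟙⟩ B) ⟨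
        + (d ℕ.+ r) * ⟨ 𝟏 , 𝟙 (S ∩ B) ⟩ + - + r * ⟨ 𝟏 , 𝟙 B ⟩
          ≡⟨ ⟨⟩-linearʳ (+ (d ℕ.+ r)) (- + r) 𝟏 (𝟙 (S ∩ B)) (𝟙 B) ⟨
        ⟨ 𝟏 , (λ v → + (d ℕ.+ r) * 𝟙 (S ∩ B) v + - + r * 𝟙 B v) ⟩
          ≡⟨ sum-cong-≗ (λ v → cong (1ℤ *_) (𝟙⊙coverVector d r S B v)) ⟨
        ⟨ 𝟏 , 𝟙 B ⊙ coverVector d r S ⟩
          ≡⟨ eigenspaces-orthogonal-on {w = 𝟙 B} (adjacency-symmetric G) sign-alternating
               𝟏-eigenvector (cover-eigenvector cover) d≢-r d≢r ⟩
        0ℤ ∎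
        where
        d≢-r : + d ≢ - + r
        d≢-r = r≢d ∘ -m≡n⇒m≡n ∘ sym
        d≢r : + d ≢ - - + r
        d≢r eq = r≢d (sym (ℤ.+-injective (trans eq (ℤ.neg-involutive (+ r)))))

      cover-product-in-part : ∀ {r₁ r₂ S₁ S₂} → IndepExactCover G d r₁ S₁ → IndepExactCover G d r₂ S₂ →
                              r₁ ≢ r₂ →
                              + (d ℕ.+ r₂) * (+ (d ℕ.+ r₁) * + ∣ S₁ ∩ S₂ ∩ B ∣ + - + r₁ * + ∣ S₂ ∩ B ∣)
                                + - + r₂ * (+ (d ℕ.+ r₁) * + ∣ S₁ ∩ B ∣ + - + r₁ * + ∣ B ∣) ≡ 0ℤ
      cover-product-in-part {r₁} {r₂} {S₁} {S₂} cover₁ cover₂ r₁≢r₂ = begin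
        + (d ℕ.+ r₂) * (+ (d ℕ.+ r₁) * + ∣ S₁ ∩ S₂ ∩ B ∣ + - + r₁ * + ∣ S₂ ∩ B ∣)
          + - + r₂ * (+ (d ℕ.+ r₁) * + ∣ S₁ ∩ B ∣ + - + r₁ * + ∣ B ∣)
          ≡⟨ cong₂ (λ p q → + (d ℕ.+ r₂) * p + - + r₂ * q)
               (⟨coverVector,𝟙⟩ d r₁ S₁ (S₂ ∩ B)) (⟨coverVector,𝟙⟩ d r₁ S₁ B) ⟨
        + (d ℕ.+ r₂) * ⟨ x₁ , 𝟙 (S₂ ∩ B) ⟩ + - + r₂ * ⟨ x₁ , 𝟙 B ⟩
          ≡⟨ ⟨⟩-linearʳ (+ (d ℕ.+ r₂)) (- + r₂) x₁ (𝟙 (S₂ ∩ B)) (𝟙 B) ⟨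
        ⟨ x₁ , (λ v → + (d ℕ.+ r₂) * 𝟙 (S₂ ∩ B) v + - + r₂ * 𝟙 B v) ⟩
          ≡⟨ sum-cong-≗ (λ v → cong (x₁ v *_) (𝟙⊙coverVector d r₂ S₂ B v)) ⟨
        ⟨ x₁ , 𝟙 B ⊙ coverVector d r₂ S₂ ⟩
          ≡⟨ eigenspaces-orthogonal-on {w = 𝟙 B} (adjacency-symmetric G) sign-alternating
               (cover-eigenvector cover₁) (cover-eigenvector cover₂) -r₁≢-r₂ -r₁≢r₂ ⟩
        0ℤ ∎
        where
        x₁ : Vector ℤ n
        x₁ = coverVector d r₁ S₁
        -r₁≢-r₂ : - + r₁ ≢ - + r₂
        -r₁≢-r₂ = r₁≢r₂ ∘ ℤ.+-injective ∘ ℤ.neg-injective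
        -r₁≢r₂ : - + r₁ ≢ - - + r₂
        -r₁≢r₂ eq = r₁≢r₂ (-m≡n⇒m≡n (trans eq (ℤ.neg-involutive (+ r₂))))

      triple-density : ∀ {r₁ r₂ S₁ S₂} → IndepExactCover G d r₁ S₁ → IndepExactCover G d r₂ S₂ →
                       r₁ ≢ r₂ → r₁ ≢ d → r₂ ≢ d →
                       (d ℕ.+ r₁) ℕ.* (d ℕ.+ r₂) ℕ.* ∣ S₁ ∩ S₂ ∩ B ∣ ≡ r₁ ℕ.* r₂ ℕ.* ∣ B ∣
      triple-density {r₁} {r₂} {S₁} {S₂} cover₁ cover₂ r₁≢r₂ r₁≢d r₂≢d = ℤ.+-injective (begin
        + ((d ℕ.+ r₁) ℕ.* (d ℕ.+ r₂) ℕ.* ∣ S₁ ∩ S₂ ∩ B ∣)   ≡⟨ pos-*³ (d ℕ.+ r₁) (d ℕ.+ r₂) _ ⟩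
        + (d ℕ.+ r₁) * + (d ℕ.+ r₂) * + ∣ S₁ ∩ S₂ ∩ B ∣
          ≡⟨ p₁p₂k≡r₁r₂m {+ (d ℕ.+ r₁)} {+ (d ℕ.+ r₂)} {+ r₁} {+ r₂}
               (cover-density-in-part cover₁ r₁≢d) (cover-density-in-part cover₂ r₂≢d)
               (cover-product-in-part cover₁ cover₂ r₁≢r₂) ⟩
        + r₁ * + r₂ * + ∣ B ∣                               ≡⟨ pos-*³ r₁ r₂ ∣ B ∣ ⟨
        + (r₁ ℕ.* r₂ ℕ.* ∣ B ∣)                             ∎)


open Spectral using (cover-density; bipartition-balanced; triple-density)

open import Data.Nat using (ℕ; _*_; _+_)
open import Data.Fin.Subset using (Subset; _∩_; ∣_∣)
open import Data.Product using (_×_)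
open import Relation.Binary.PropositionalEquality using (_≡_; _≢_)
open import Data.Empty using (⊥-elim)
open import Data.Nat.Base using (zero; suc; NonZero)
import Data.Nat.Properties as ℕ
open import Data.Nat.Tactic.RingSolver using (solve-∀)
open import Data.Product using (_,_)
open import Relation.Binary.PropositionalEquality using (sym; trans; cong; cong₂; module ≡-Reasoning)

open ≡-Reasoning

n*n*k≡s₁*s₂*m : ∀ {p₁ p₂ r₁ r₂ n m s₁ s₂ k} .{{_ : NonZero (p₁ * p₂)}} →
                p₁ * s₁ ≡ r₁ * n → p₂ * s₂ ≡ r₂ * n → p₁ * p₂ * k ≡ r₁ * r₂ * m →
                n * n * k ≡ s₁ * s₂ * m
n*n*k≡s₁*s₂*m {p₁} {p₂} {r₁} {r₂} {n} {m} {s₁} {s₂} {k} e₁ e₂ e =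
  ℕ.*-cancelˡ-≡ (n * n * k) (s₁ * s₂ * m) (p₁ * p₂) (begin
    p₁ * p₂ * (n * n * k)     ≡⟨ swap₁ p₁ p₂ n k ⟩
    n * n * (p₁ * p₂ * k)     ≡⟨ cong (n * n *_) e ⟩
    n * n * (r₁ * r₂ * m)     ≡⟨ swap₂ r₁ r₂ n m ⟩
    r₁ * n * (r₂ * n) * m     ≡⟨ cong₂ (λ a b → a * b * m) e₁ e₂ ⟨
    p₁ * s₁ * (p₂ * s₂) * m   ≡⟨ swap₃ p₁ p₂ s₁ s₂ m ⟩
    p₁ * p₂ * (s₁ * s₂ * m)   ∎)
  where
  swap₁ : ∀ p₁ p₂ n k → p₁ * p₂ * (n * n * k) ≡ n * n * (p₁ * p₂ * k)
  swap₁ = solve-∀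
  swap₂ : ∀ r₁ r₂ n m → n * n * (r₁ * r₂ * m) ≡ r₁ * n * (r₂ * n) * m
  swap₂ = solve-∀
  swap₃ : ∀ p₁ p₂ s₁ s₂ m → p₁ * s₁ * (p₂ * s₂) * m ≡ p₁ * p₂ * (s₁ * s₂ * m)
  swap₃ = solve-∀

2*p₁*p₂*k≡r₁*r₂*n : ∀ {p₁ p₂ r₁ r₂ n m k} → n ≡ m + m → p₁ * p₂ * k ≡ r₁ * r₂ * m →
                    2 * p₁ * p₂ * k ≡ r₁ * r₂ * n
2*p₁*p₂*k≡r₁*r₂*n {p₁} {p₂} {r₁} {r₂} {n} {m} {k} n≡2m e = begin
  2 * p₁ * p₂ * k                   ≡⟨ double p₁ p₂ k ⟩
  p₁ * p₂ * k + p₁ * p₂ * k         ≡⟨ cong₂ _+_ e e ⟩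
  r₁ * r₂ * m + r₁ * r₂ * m         ≡⟨ factor r₁ r₂ m ⟩
  r₁ * r₂ * (m + m)                 ≡⟨ cong (r₁ * r₂ *_) n≡2m ⟨
  r₁ * r₂ * n                       ∎
  where
  double : ∀ p₁ p₂ k → 2 * p₁ * p₂ * k ≡ p₁ * p₂ * k + p₁ * p₂ * k
  double = solve-∀
  factor : ∀ r₁ r₂ m → r₁ * r₂ * m + r₁ * r₂ * m ≡ r₁ * r₂ * (m + m)
  factor = solve-∀

lemma4p6 : (n d r₁ r₂ : ℕ) (G : SimpleGraph n) (S₁ S₂ S₃ : Subset n) →
           Regular G d →
           IndepExactCover G d r₁ S₁ →
           IndepExactCover G d r₂ S₂ →
           IndepExactCover G d d S₃ →
           r₁ ≢ r₂ → r₁ ≢ d → r₂ ≢ d →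
           (n * n * ∣ S₁ ∩ S₂ ∩ S₃ ∣ ≡ ∣ S₁ ∣ * ∣ S₂ ∣ * ∣ S₃ ∣)
           × (2 * (d + r₁) * (d + r₂) * ∣ S₁ ∩ S₂ ∩ S₃ ∣ ≡ r₁ * r₂ * n)
lemma4p6 n zero r₁ r₂ G S₁ S₂ S₃ _ (r₁≤0 , _) (r₂≤0 , _) _ r₁≢r₂ _ _ =
  ⊥-elim (r₁≢r₂ (trans (ℕ.n≤0⇒n≡0 r₁≤0) (sym (ℕ.n≤0⇒n≡0 r₂≤0))))
lemma4p6 n d@(suc _) r₁ r₂ G S₁ S₂ S₃ regular cover₁ cover₂ cover₃ r₁≢r₂ r₁≢d r₂≢d =
    n*n*k≡s₁*s₂*m {d + r₁} {d + r₂} {r₁} {r₂} {n} {∣ S₃ ∣} density₁ density₂ triple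
  , 2*p₁*p₂*k≡r₁*r₂*n {d + r₁} {d + r₂} {r₁} {r₂} (bipartition-balanced G regular cover₃ (λ ())) triple
  where
  density₁ : (d + r₁) * ∣ S₁ ∣ ≡ r₁ * n
  density₁ = cover-density G regular cover₁ r₁≢d
  density₂ : (d + r₂) * ∣ S₂ ∣ ≡ r₂ * n
  density₂ = cover-density G regular cover₂ r₂≢d
  triple : (d + r₁) * (d + r₂) * ∣ S₁ ∩ S₂ ∩ S₃ ∣ ≡ r₁ * r₂ * ∣ S₃ ∣
  triple = triple-density G regular cover₃ cover₁ cover₂ r₁≢r₂ r₁≢d r₂≢d
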